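{- Let $n,k,x,y$ be integers with $1\le k\le n$ and $x,y\in[n-k]$. Let $A'\in\{0,1\}^{n\times n}$ be any binary matrix and $\sigma_1,\sigma_2:[n]\to[n]$ any permutations. Let $G(A')$ be the bipartite graph with vertex classes $U=\{u_1,\dots,u_n\}$, $V=\{v_1,\dots,v_n\}$ and an edge $u_av_b$ iff $A'_{a,b}=1$, and let $E_S=\{u_{\sigma_1(i)}v_{\sigma_2(j)} : (i,j)\in S(x,y),\ A'_{\sigma_1(i),\sigma_2(j)}=1\}$. Then the size of a minimum vertex cover of $G(A')-E_S$ is at most $2(n-k)+1$.
   Context: $[m]=\{1,\dots,m\}$ and $S(x,y)=\{(i,j)\in[n]^2 : x\le i<x+k,\ y\le j<y+k\}\setminus\{(x,y)\}$. $G(A')-E_S$ is the graph obtained from $G(A')$ by deleting the edges of $E_S$. -}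

module Defs where

open import Data.Nat using (ℕ; suc; _+_; _≤_; _<_)
open import Data.Fin using (Fin; toℕ)
open import Data.Fin.Subset using (Subset; _∈_; ∣_∣)
open import Data.Fin.Permutation using (Permutation′; _⟨$⟩ʳ_)
open import Data.Bool using (Bool; true)
open import Data.Product using (_×_; ∃; ∃-syntax; _,_)
open import Data.Sum using (_⊎_)
open import Relation.Binary.PropositionalEquality using (_≡_)
open import Relation.Nullary using (¬_)

-- Convention: [n] = {1,…,n} is represented by Fin n, where i : Fin n
-- stands for the integer toℕ i + 1.
val : {n : ℕ} → Fin n → ℕ
val i = suc (toℕ i)

BinMatrix : ℕ → Set
BinMatrix n = Fin n → Fin n → Bool

InS : (n k x y : ℕ) → Fin n → Fin n → Set
InS n k x y i j =
  (x ≤ val i) × (val i < x + k) × (y ≤ val j) × (val j < y + k)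
  × ¬ ((val i ≡ x) × (val j ≡ y))

EdgeG : {n : ℕ} → BinMatrix n → Fin n → Fin n → Set
EdgeG A a b = A a b ≡ true

InES : (n k x y : ℕ) → BinMatrix n → Permutation′ n → Permutation′ n →
       Fin n → Fin n → Set
InES n k x y A σ₁ σ₂ a b =
  ∃[ i ] ∃[ j ] (InS n k x y i j × (σ₁ ⟨$⟩ʳ i ≡ a) × (σ₂ ⟨$⟩ʳ j ≡ b)
                 × A (σ₁ ⟨$⟩ʳ i) (σ₂ ⟨$⟩ʳ j) ≡ true)

EdgeGminusES : (n k x y : ℕ) → BinMatrix n → Permutation′ n → Permutation′ n →
               Fin n → Fin n → Set
EdgeGminusES n k x y A σ₁ σ₂ a b = EdgeG A a b × ¬ InES n k x y A σ₁ σ₂ a b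

IsVertexCover : {n : ℕ} → (Fin n → Fin n → Set) → Subset n → Subset n → Set
IsVertexCover {n} E CU CV = ∀ (a b : Fin n) → E a b → (a ∈ CU) ⊎ (b ∈ CV)

coverSize : {n : ℕ} → Subset n → Subset n → ℕ
coverSize CU CV = ∣ CU ∣ + ∣ CV ∣

-- "The minimum vertex cover of the graph has size at most m"
-- ⇔ some vertex cover has size at most m.
MinVertexCoverAtMost : {n : ℕ} → (Fin n → Fin n → Set) → ℕ → Set
MinVertexCoverAtMost {n} E m =
  ∃[ CU ] ∃[ CV ] (IsVertexCover E CU CV × coverSize {n} CU CV ≤ m)

module Submission where

-- Every edge of E_S has been
-- deleted, so G(A') - E_S has no edge u_{σ₁(i)} v_{σ₂(j)} with
--   x < i < x + k   (a block of k - 1 rows)   and   y ≤ j < y + k   (k columns),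
-- because every such (i,j) lies in S(x,y): the only excluded pair (x,y) has
-- i = x.  Hence the u's outside σ₁(row block) together with the v's outside
-- σ₂(column block) cover every remaining edge, and this cover has at most
-- (n - (k - 1)) + (n - k) = 2(n - k) + 1 vertices.

open import Defs
open import Data.Nat using (ℕ; _≤_; _∸_; _+_; _*_)
open import Data.Fin.Permutation using (Permutation′)

open import Data.Nat using (zero; suc; _<_; z≤n; s≤s; _≤?_; _<?_)
open import Data.Nat.Properties
open import Data.Fin using (Fin; toℕ) renaming (zero to fzero; suc to fsuc)
open import Data.Fin.Permutation using (_⟨$⟩ˡ_; inverseʳ; flip)
open import Data.Fin.Subset using (Subset; Side; _∈_; ∣_∣)
open import Data.Fin.Subset.Properties using (∣p∣≤n)
open import Data.Bool using (Bool; true; false; not)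
open import Data.Vec using (_∷_; tabulate)
open import Data.Vec.Properties using (lookup⇒[]=; lookup∘tabulate)
open import Data.Product using (_×_; _,_)
open import Data.Sum using (inj₁; inj₂)
open import Data.Empty using (⊥; ⊥-elim)
open import Relation.Nullary using (Dec; yes; no; does; ¬_; _×-dec_)
open import Relation.Nullary.Decidable using (dec-true; dec-false)
open import Relation.Binary.PropositionalEquality
open import Function using (_∘_)
open import Algebra.Properties.CommutativeMonoid.Sum +-0-commutativeMonoid
  using (sum; sum-permute)

indicator : Bool → ℕ
indicator true  = 1
indicator false = 0

∣tabulate∣≡sum : ∀ {n} (f : Fin n → Side) → ∣ tabulate f ∣ ≡ sum (indicator ∘ f)
∣tabulate∣≡sum {zero}  f = refl
∣tabulate∣≡sum {suc n} f with f fzero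
... | true  = cong suc (∣tabulate∣≡sum (f ∘ fsuc))
... | false = ∣tabulate∣≡sum (f ∘ fsuc)

∣tabulate∘permute∣ : ∀ {n} (σ : Permutation′ n) (f : Fin n → Side) →
                     ∣ tabulate (f ∘ (σ ⟨$⟩ˡ_)) ∣ ≡ ∣ tabulate f ∣
∣tabulate∘permute∣ σ f = begin
  ∣ tabulate (f ∘ (σ ⟨$⟩ˡ_)) ∣    ≡⟨ ∣tabulate∣≡sum (f ∘ (σ ⟨$⟩ˡ_)) ⟩
  sum (indicator ∘ f ∘ (σ ⟨$⟩ˡ_))  ≡⟨ sum-permute (indicator ∘ f) (flip σ) ⟨
  sum (indicator ∘ f)              ≡⟨ ∣tabulate∣≡sum f ⟨
  ∣ tabulate f ∣                   ∎
  where open ≡-Reasoning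

∣b∷p∣≤1+∣p∣ : ∀ {n} (b : Side) (p : Subset n) → ∣ b ∷ p ∣ ≤ suc ∣ p ∣
∣b∷p∣≤1+∣p∣ true  p = ≤-refl
∣b∷p∣≤1+∣p∣ false p = n≤1+n ∣ p ∣

Window : ℕ → ℕ → ℕ → Set
Window lo len m = lo ≤ m × m < lo + len

window? : ∀ lo len m → Dec (Window lo len m)
window? lo len m = lo ≤? m ×-dec m <? lo + len

vanishing-on-window : ∀ n lo len (g : ℕ → Bool) → lo + len ≤ n →
                      (∀ m → Window lo len m → g m ≡ false) →
                      ∣ tabulate {n = n} (g ∘ toℕ) ∣ + len ≤ n
vanishing-on-window n zero zero g _ _ =
  subst (_≤ n) (sym (+-identityʳ _)) (∣p∣≤n (tabulate (g ∘ toℕ)))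
vanishing-on-window (suc n) zero (suc len) g (s≤s fits) vanishes
  rewrite vanishes 0 (z≤n , s≤s z≤n) =
  subst (_≤ suc n) (sym (+-suc _ len))
    (s≤s (vanishing-on-window n zero len (g ∘ suc) fits
            (λ { m (_ , m<len) → vanishes (suc m) (z≤n , s≤s m<len) })))
vanishing-on-window (suc n) (suc lo) len g (s≤s fits) vanishes =
  ≤-trans (+-monoˡ-≤ len (∣b∷p∣≤1+∣p∣ (g 0) (tabulate {n = n} (g ∘ suc ∘ toℕ))))
    (s≤s (vanishing-on-window n lo len (g ∘ suc) fits
            (λ { m (lo≤m , m<end) → vanishes (suc m) (s≤s lo≤m , s≤s m<end) })))

avoiding : ∀ {n} → Permutation′ n → ℕ → ℕ → Subset n
avoiding σ lo len = tabulate (λ a → not (does (window? lo len (toℕ (σ ⟨$⟩ˡ a)))))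

∈avoiding : ∀ {n} (σ : Permutation′ n) lo len (a : Fin n) →
            ¬ Window lo len (toℕ (σ ⟨$⟩ˡ a)) → a ∈ avoiding σ lo len
∈avoiding σ lo len a outsideWindow =
  lookup⇒[]= a (avoiding σ lo len)
    (trans (lookup∘tabulate _ a) (cong not (dec-false (window? lo len _) outsideWindow)))

-- Since σ is a bijection, the image of the window has exactly len elements,
-- so at most n - len vertices avoid it.
∣avoiding∣≤ : ∀ {n} (σ : Permutation′ n) lo len → lo + len ≤ n →
              ∣ avoiding σ lo len ∣ ≤ n ∸ len
∣avoiding∣≤ {n} σ lo len fits =
  subst (_≤ n ∸ len) (sym (∣tabulate∘permute∣ σ (outsideWindow ∘ toℕ)))
    (m+n≤o⇒m≤o∸n _ (vanishing-on-window n lo len outsideWindow fits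
      (λ m inWindow → cong not (dec-true (window? lo len m) inWindow))))
  where
  outsideWindow : ℕ → Bool
  outsideWindow m = not (does (window? lo len m))

windowFreeCover : ∀ {n} (E : Fin n → Fin n → Set) (σ₁ σ₂ : Permutation′ n)
                  lo₁ len₁ lo₂ len₂ → lo₁ + len₁ ≤ n → lo₂ + len₂ ≤ n →
                  (∀ a b → E a b → Window lo₁ len₁ (toℕ (σ₁ ⟨$⟩ˡ a)) →
                                   Window lo₂ len₂ (toℕ (σ₂ ⟨$⟩ˡ b)) → ⊥) →
                  MinVertexCoverAtMost E ((n ∸ len₁) + (n ∸ len₂))
windowFreeCover E σ₁ σ₂ lo₁ len₁ lo₂ len₂ fits₁ fits₂ noEdge =
  avoiding σ₁ lo₁ len₁ , avoiding σ₂ lo₂ len₂ , covers ,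
  +-mono-≤ (∣avoiding∣≤ σ₁ lo₁ len₁ fits₁) (∣avoiding∣≤ σ₂ lo₂ len₂ fits₂)
  where
  covers : IsVertexCover E (avoiding σ₁ lo₁ len₁) (avoiding σ₂ lo₂ len₂)
  covers a b edge with window? lo₁ len₁ (toℕ (σ₁ ⟨$⟩ˡ a))
                     | window? lo₂ len₂ (toℕ (σ₂ ⟨$⟩ˡ b))
  ... | no  a∉W₁ | _        = inj₁ (∈avoiding σ₁ lo₁ len₁ a a∉W₁)
  ... | yes _    | no b∉W₂  = inj₂ (∈avoiding σ₂ lo₂ len₂ b b∉W₂)
  ... | yes a∈W₁ | yes b∈W₂ = ⊥-elim (noEdge a b edge a∈W₁ b∈W₂)

-- Rows x < val i < x + k (0-based window [x, x + k′)) and columns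
-- y ≤ val j < y + k (0-based window [y′, y′ + k)) span a block inside S(x,y):
-- the excluded corner (x,y) has val i = x, which the row window omits.
block⊆S : ∀ n k′ x y′ (i j : Fin n) →
          Window x k′ (toℕ i) → Window y′ (suc k′) (toℕ j) →
          InS n (suc k′) x (suc y′) i j
block⊆S n k′ x y′ i j (x≤i , i<x+k′) (y′≤j , j<y′+k) =
  m≤n⇒m≤1+n x≤i , subst (suc (toℕ i) <_) (sym (+-suc x k′)) (s≤s i<x+k′) ,
  s≤s y′≤j , s≤s j<y′+k , λ { (i+1≡x , _) → 1+n≰n (subst (_≤ toℕ i) (sym i+1≡x) x≤i) }

blocks-edge-free : ∀ n k′ x y′ (A : BinMatrix n) (σ₁ σ₂ : Permutation′ n) a b →
                   EdgeGminusES n (suc k′) x (suc y′) A σ₁ σ₂ a b →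
                   Window x k′ (toℕ (σ₁ ⟨$⟩ˡ a)) →
                   Window y′ (suc k′) (toℕ (σ₂ ⟨$⟩ˡ b)) → ⊥
blocks-edge-free n k′ x y′ A σ₁ σ₂ a b (edge , notInES) rowWindow columnWindow =
  notInES (i , j , block⊆S n k′ x y′ i j rowWindow columnWindow ,
           inverseʳ σ₁ , inverseʳ σ₂ ,
           subst₂ (λ a′ b′ → A a′ b′ ≡ true) (sym (inverseʳ σ₁)) (sym (inverseʳ σ₂)) edge)
  where
  i = σ₁ ⟨$⟩ˡ a
  j = σ₂ ⟨$⟩ˡ b

lemma7 : (n k x y : ℕ) → 1 ≤ k → k ≤ n →
    1 ≤ x → x ≤ n ∸ k → 1 ≤ y → y ≤ n ∸ k →
    (A : BinMatrix n) → (σ₁ σ₂ : Permutation′ n) →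
    MinVertexCoverAtMost (EdgeGminusES n k x y A σ₁ σ₂) (2 * (n ∸ k) + 1)
lemma7 n (suc k′) x (suc y′) (s≤s z≤n) k≤n _ x≤n∸k (s≤s z≤n) y≤n∸k A σ₁ σ₂ =
  let (CU , CV , covers , size) =
        windowFreeCover (EdgeGminusES n k x y A σ₁ σ₂) σ₁ σ₂ x k′ y′ k
          rowsFit columnsFit (blocks-edge-free n k′ x y′ A σ₁ σ₂)
  in CU , CV , covers , ≤-trans size (≤-reflexive sizeBound)
  where
  k = suc k′
  y = suc y′
  x+k≤n : x + k ≤ n
  x+k≤n = m≤o∸n⇒m+n≤o x k≤n x≤n∸k
  rowsFit : x + k′ ≤ n
  rowsFit = ≤-trans (+-monoʳ-≤ x (n≤1+n k′)) x+k≤n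
  columnsFit : y′ + k ≤ n
  columnsFit = ≤-trans (n≤1+n (y′ + k)) (m≤o∸n⇒m+n≤o y k≤n y≤n∸k)
  -- n - (k - 1) = (n - k) + 1, so the two sides together give 2(n - k) + 1.
  sizeBound : (n ∸ k′) + (n ∸ k) ≡ 2 * (n ∸ k) + 1
  sizeBound = begin
    (n ∸ k′) + (n ∸ k)        ≡⟨ cong (_+ (n ∸ k)) (+-∸-assoc 1 k≤n) ⟩
    suc (n ∸ k) + (n ∸ k)     ≡⟨ +-comm 1 ((n ∸ k) + (n ∸ k)) ⟩
    (n ∸ k) + (n ∸ k) + 1     ≡⟨ cong (λ t → (n ∸ k) + t + 1) (+-identityʳ (n ∸ k)) ⟨
    2 * (n ∸ k) + 1           ∎
    where open ≡-Reasoning
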